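{- Let $X=\{X^1,\dots,X^m\}\subseteq\mathcal{S}_n$ (distinct elements). Then $$\Big|\bigcap_{i=1}^m\mathcal{E}(\{X^i\})\Big|=3^{z_X}\Big(-(-2)^{m-1}+\sum_{\alpha\in\mathcal{S}_m}(-1)^{z(\alpha)}2^{\,z(\alpha)+|\mathrm{BSp}(X,\alpha)|}\Big).$$
   Context: $\mathcal{S}_n$ is the set of nonzero tuples in $\{ -1,0,1\}^n$ whose first nonzero entry is $1$. A tuple $t\in\{1,0,-1,u\}^n$ eliminates $s\in\mathcal{S}_n$ if: (i) $t_i\neq0$ and $s_i\ne0$ for some $i$; (ii) there is $k\in\{+1,-1\}$ with $t_i=ks_i$ for all $i$ with $s_i\ne0$ and $t_i\ne0$; (iii) $s_i=0$ whenever $t_i=u$. For a set $Y$ of tuples, $\mathcal{E}(Y)$ is the set of elements of $\mathcal{S}_n$ eliminated by some element of $Y$. $M_X$ is the $m\times n$ matrix whose $i$-th row is $X^i$; $z_X$ is the number of zero columns of $M_X$; for a tuple $\alpha$, $z(\alpha)$ is its number of zero coordinates. For $\alpha=(\alpha_1,\dots,\alpha_m)\in\mathcal{S}_m$, $\mathrm{BSp}(X,\alpha)$ is the set of column indices $j\in\{1,\dots,n\}$ such that the $j$-th column of $M_X$ equals $\pm\sum_{i=1}^m a_i\alpha_ie_i$ for some $(a_1,\dots,a_m)\in\{0,1\}^m\setminus\{(0,\dots,0)\}$, where $e_i$ are the standard basis vectors of $\mathbb{R}^m$. -}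

module Defs where

open import Data.Nat using (ℕ; zero; suc)
open import Data.Bool using (Bool; true; false; _∧_; _∨_; not; if_then_else_)
open import Data.List using (List; []; _∷_; map; concatMap; filter; length; foldr)
open import Data.Bool.ListAction using (and; or; any)
open import Relation.Nullary using (yes; no)
open import Data.Vec using (Vec; []; _∷_; toList; zipWith; lookup; tabulate)
import Data.Vec as V
open import Data.Fin using (Fin)
open import Data.Fin.Base using () renaming (toℕ to finToℕ)
open import Data.Integer using (ℤ; +_; -_; _+_; _*_; _^_)
open import Relation.Nullary using (Dec)
open import Data.Bool using (T)

-- Entries of tuples in {-1,0,1}: t+ = 1, t0 = 0, t- = -1
data Trit : Set where
  t+ t0 t- : Trit

-- Entries of tuples in {1,0,-1,u}
data Quad : Set where
  q1 q0 qm qu : Quad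

embed : Trit → Quad
embed t+ = q1
embed t0 = q0
embed t- = qm

_==T_ : Trit → Trit → Bool
t+ ==T t+ = true
t0 ==T t0 = true
t- ==T t- = true
_ ==T _ = false

_==Q_ : Quad → Quad → Bool
q1 ==Q q1 = true
q0 ==Q q0 = true
qm ==Q qm = true
qu ==Q qu = true
_ ==Q _ = false

negT : Trit → Trit
negT t+ = t-
negT t0 = t0
negT t- = t+

nzT : Trit → Bool
nzT t0 = false
nzT _ = true

nzQ : Quad → Bool
nzQ q0 = false
nzQ _ = true

_==V_ : ∀ {n} → Vec Trit n → Vec Trit n → Bool
u ==V v = and (toList (zipWith _==T_ u v))

allTrits : ∀ n → List (Vec Trit n)
allTrits zero = [] ∷ []
allTrits (suc n) = concatMap (λ x → map (x ∷_) (allTrits n)) (t+ ∷ t0 ∷ t- ∷ [])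

allBools : ∀ n → List (Vec Bool n)
allBools zero = [] ∷ []
allBools (suc n) = concatMap (λ x → map (x ∷_) (allBools n)) (false ∷ true ∷ [])

T? : (b : Bool) → Dec (T b)
T? true = yes _
T? false = no (λ ())

isS : ∀ {n} → Vec Trit n → Bool
isS [] = false
isS (t0 ∷ v) = isS v
isS (t+ ∷ v) = true
isS (t- ∷ v) = false

S : ∀ n → List (Vec Trit n)
S n = filter (λ v → T? (isS v)) (allTrits n)

-- k * s_i for k ∈ {+1,-1} (k = true means +1)
scale : Bool → Trit → Quad
scale true x = embed x
scale false x = embed (negT x)

eliminates : ∀ {n} → Vec Quad n → Vec Trit n → Bool
eliminates t s = c1 ∧ c2 ∧ c3
  where
    c1 = or (toList (zipWith (λ a b → nzQ a ∧ nzT b) t s))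
    c2 = any (λ k → and (toList (zipWith (λ a b → if nzQ a ∧ nzT b then a ==Q scale k b else true) t s)))
             (true ∷ false ∷ [])
    c3 = and (toList (zipWith (λ a b → if a ==Q qu then b ==T t0 else true) t s))

-- |∩_{i} E({X^i})| where X is given as the rows of M_X
card∩E : ∀ {m n} → Vec (Vec Trit n) m → ℕ
card∩E {n = n} X =
  length (filter (λ s → T? (and (toList (V.map (λ Xi → eliminates (V.map embed Xi) s) X)))) (S n))

count : List Bool → ℕ
count [] = 0
count (true ∷ bs) = suc (count bs)
count (false ∷ bs) = count bs

column : ∀ {m n} → Vec (Vec Trit n) m → Fin n → Vec Trit m
column X j = V.map (λ row → lookup row j) X

zX : ∀ {m n} → Vec (Vec Trit n) m → ℕ
zX {n = n} X = count (toList (tabulate {n = n} (λ j → and (toList (V.map (λ x → x ==T t0) (column X j))))))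

zcount : ∀ {k} → Vec Trit k → ℕ
zcount α = count (toList (V.map (λ x → x ==T t0) α))

combo : ∀ {k} → Vec Bool k → Vec Trit k → Vec Trit k
combo a α = zipWith (λ ai x → if ai then x else t0) a α

bsp : ∀ {m n} → Vec (Vec Trit n) m → Vec Trit m → ℕ
bsp {m} {n} X α = count (toList (tabulate {n = n} (λ j →
  any (λ a → or (toList a) ∧ or (toList (V.map nzT (combo a α)))
               ∧ (column X j ==V combo a α ∨ column X j ==V V.map negT (combo a α)))
      (allBools m))))

sumℤ : List ℤ → ℤ
sumℤ = foldr _+_ (+ 0)

rhs : ∀ {m n} → Vec (Vec Trit n) m → ℤ
rhs {m} X = ((+ 3) ^ zX X) *
  ((- ((- (+ 2)) ^ (m Data.Nat.∸ 1)))
   + sumℤ (map (λ α → ((- (+ 1)) ^ zcount α) * ((+ 2) ^ (zcount α Data.Nat.+ bsp X α))) (S m)))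

-- For one row x, the indicator of "x eliminates s" equals
-- [x agrees with s] − 2 [x and s have disjoint supports] + [x agrees with −s].
-- Multiplying over the rows and expanding gives a signed sum over sign patterns
-- β ∈ {1,0,−1}^m with weights (−2)^z(β). Summed over all s ∈ {−1,0,1}^n, the term of β
-- factorises over the columns of M_X: a column contributes 3 if it is zero, 2 if it lies
-- in BSp(X,β) and 1 otherwise. Both sums are symmetric under s ↦ −s and β ↦ −β; the zero
-- vector s is never eliminated and β = 0 contributes (−2)^m 3^z_X, so halving both sides
-- gives the formula.

module Submission where

open import Defs
open import Data.Nat using (ℕ; _≤_; zero; suc; s≤s)
import Data.Nat as ℕ
open import Data.Bool using (Bool; true; false; T; _∧_; _∨_; not; if_then_else_)
open import Data.Bool.Properties using (∧-commutativeMonoid; ∨-comm; ∨-identityʳ; T-∧; T-∨)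
open import Data.Bool.ListAction using (and; or; any)
import Data.Fin as Fin
open import Data.Vec using (Vec; []; _∷_; lookup; toList; zipWith; tabulate)
import Data.Vec as V
import Data.Vec.Properties as VP
open import Data.List using (List; []; _∷_; map; filter; length; _++_)
open import Data.List.Membership.Propositional using (_∈_; lose)
open import Data.List.Membership.Propositional.Properties using (∈-map⁺; ∈-++⁺ˡ; ∈-++⁺ʳ)
open import Data.List.Relation.Unary.Any using (here; satisfied)
open import Data.List.Relation.Unary.Any.Properties using (any⁺; any⁻)
open import Data.Integer using (ℤ; +_; -_; _+_; _*_; _^_)
open import Data.Integer.Properties
  using (+-identityˡ; +-identityʳ; +-assoc; *-assoc; *-identityˡ; *-identityʳ; *-zeroʳ; *-distribˡ-+; ^-distribˡ-+-*; *-cancelˡ-≡)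
open import Data.Integer.Tactic.RingSolver using (solve-∀)
open import Data.Empty using (⊥; ⊥-elim)
open import Data.Product using (_,_; proj₁; proj₂)
open import Data.Sum using (_⊎_; inj₁; inj₂)
open import Function using (_∘_; Equivalence)
open Equivalence using (to; from)
open import Algebra.Bundles using (CommutativeMonoid)
open import Algebra.Properties.CommutativeSemigroup (CommutativeMonoid.commutativeSemigroup ∧-commutativeMonoid)
  using () renaming (interchange to ∧-interchange)
open import Relation.Binary.PropositionalEquality

open ≡-Reasoning

⟦_⟧ : Bool → ℤ
⟦ true ⟧ = + 1
⟦ false ⟧ = + 0

⟦∧⟧ : ∀ a b → ⟦ a ∧ b ⟧ ≡ ⟦ a ⟧ * ⟦ b ⟧
⟦∧⟧ true b = sym (*-identityˡ ⟦ b ⟧)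
⟦∧⟧ false b = refl

∧≡true⇒left : ∀ {x y} → x ∧ y ≡ true → x ≡ true
∧≡true⇒left {true} _ = refl

T-ext : ∀ {x y} → (T x → T y) → (T y → T x) → x ≡ y
T-ext {false} {false} _ _ = refl
T-ext {false} {true} _ y⇒x = ⊥-elim (y⇒x _)
T-ext {true} {false} x⇒y _ = ⊥-elim (x⇒y _)
T-ext {true} {true} _ _ = refl

toℕ : Bool → ℕ
toℕ true = 1
toℕ false = 0

∑ : {A : Set} → List A → (A → ℤ) → ℤ
∑ [] f = + 0
∑ (x ∷ xs) f = f x + ∑ xs f

sumℤ-map : {A : Set} (f : A → ℤ) (xs : List A) → sumℤ (map f xs) ≡ ∑ xs f
sumℤ-map f [] = refl
sumℤ-map f (x ∷ xs) = cong (_+_ (f x)) (sumℤ-map f xs)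

∑-cong : {A : Set} (xs : List A) {f g : A → ℤ} → (∀ x → f x ≡ g x) → ∑ xs f ≡ ∑ xs g
∑-cong [] f≗g = refl
∑-cong (x ∷ xs) f≗g = cong₂ _+_ (f≗g x) (∑-cong xs f≗g)

∑-++ : {A : Set} (xs ys : List A) (f : A → ℤ) → ∑ (xs ++ ys) f ≡ ∑ xs f + ∑ ys f
∑-++ [] ys f = sym (+-identityˡ _)
∑-++ (x ∷ xs) ys f = trans (cong (_+_ (f x)) (∑-++ xs ys f)) (sym (+-assoc (f x) _ _))

∑-map : {A B : Set} (g : A → B) (xs : List A) (f : B → ℤ) → ∑ (map g xs) f ≡ ∑ xs (f ∘ g)
∑-map g [] f = refl
∑-map g (x ∷ xs) f = cong (_+_ (f (g x))) (∑-map g xs f)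

∑-+ : {A : Set} (xs : List A) (f g : A → ℤ) → ∑ xs (λ x → f x + g x) ≡ ∑ xs f + ∑ xs g
∑-+ [] f g = refl
∑-+ (x ∷ xs) f g = trans (cong (_+_ (f x + g x)) (∑-+ xs f g)) (interchange (f x) (g x) _ _)
  where
  interchange : ∀ a b c d → (a + b) + (c + d) ≡ (a + c) + (b + d)
  interchange = solve-∀

∑-distribˡ : {A : Set} (xs : List A) (c : ℤ) (f : A → ℤ) → ∑ xs (λ x → c * f x) ≡ c * ∑ xs f
∑-distribˡ [] c f = sym (*-zeroʳ c)
∑-distribˡ (x ∷ xs) c f = trans (cong (_+_ (c * f x)) (∑-distribˡ xs c f)) (sym (*-distribˡ-+ c (f x) _))

∑-zero : {A : Set} (xs : List A) → ∑ xs (λ _ → + 0) ≡ + 0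
∑-zero [] = refl
∑-zero (_ ∷ xs) = trans (+-identityˡ _) (∑-zero xs)

∑-comm : {A B : Set} (xs : List A) (ys : List B) (f : A → B → ℤ) →
  ∑ xs (λ x → ∑ ys (f x)) ≡ ∑ ys (λ y → ∑ xs (λ x → f x y))
∑-comm [] ys f = sym (∑-zero ys)
∑-comm (x ∷ xs) ys f = trans (cong (_+_ (∑ ys (f x))) (∑-comm xs ys f)) (sym (∑-+ ys (f x) _))

∑-filter : {A : Set} (p : A → Bool) (xs : List A) (f : A → ℤ) →
  ∑ (filter (T? ∘ p) xs) f ≡ ∑ xs (λ x → ⟦ p x ⟧ * f x)
∑-filter p [] f = refl
∑-filter p (x ∷ xs) f with p x
... | true = cong₂ _+_ (sym (*-identityˡ (f x))) (∑-filter p xs f)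
... | false = trans (∑-filter p xs f) (sym (+-identityˡ _))

length-filter : {A : Set} (p : A → Bool) (xs : List A) → + length (filter (T? ∘ p) xs) ≡ ∑ xs (⟦_⟧ ∘ p)
length-filter p [] = refl
length-filter p (x ∷ xs) with p x
... | true = cong (_+_ (+ 1)) (length-filter p xs)
... | false = trans (length-filter p xs) (sym (+-identityˡ _))

neg : ∀ {n} → Vec Trit n → Vec Trit n
neg = V.map negT

zeros : ∀ n → Vec Trit n
zeros n = V.replicate n t0

neg-involutive : ∀ {m} (c : Vec Trit m) → neg (neg c) ≡ c
neg-involutive [] = refl
neg-involutive (t+ ∷ c) = cong (t+ ∷_) (neg-involutive c)
neg-involutive (t0 ∷ c) = cong (t0 ∷_) (neg-involutive c)
neg-involutive (t- ∷ c) = cong (t- ∷_) (neg-involutive c)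

nzT-neg : ∀ {m} (c : Vec Trit m) → V.map nzT (neg c) ≡ V.map nzT c
nzT-neg [] = refl
nzT-neg (t+ ∷ c) = cong (true ∷_) (nzT-neg c)
nzT-neg (t0 ∷ c) = cong (false ∷_) (nzT-neg c)
nzT-neg (t- ∷ c) = cong (true ∷_) (nzT-neg c)

∑-allTrits-suc : ∀ n (f : Vec Trit (suc n) → ℤ) → ∑ (allTrits (suc n)) f ≡
  ∑ (allTrits n) (f ∘ (t+ ∷_)) + (∑ (allTrits n) (f ∘ (t0 ∷_)) + ∑ (allTrits n) (f ∘ (t- ∷_)))
∑-allTrits-suc n f = begin
  ∑ (A+ ++ (A0 ++ (A- ++ []))) f                ≡⟨ ∑-++ A+ _ f ⟩
  ∑ A+ f + ∑ (A0 ++ (A- ++ [])) f              ≡⟨ cong (_+_ (∑ A+ f)) (∑-++ A0 _ f) ⟩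
  ∑ A+ f + (∑ A0 f + ∑ (A- ++ []) f)          ≡⟨ cong (λ z → ∑ A+ f + (∑ A0 f + z)) (trans (∑-++ A- [] f) (+-identityʳ _)) ⟩
  ∑ A+ f + (∑ A0 f + ∑ A- f)                  ≡⟨ cong₂ _+_ (∑-map _ As f) (cong₂ _+_ (∑-map _ As f) (∑-map _ As f)) ⟩
  _ ∎
  where
  As = allTrits n
  A+ = map (t+ ∷_) As
  A0 = map (t0 ∷_) As
  A- = map (t- ∷_) As

∑-allTrits-neg : ∀ n (f : Vec Trit n → ℤ) → ∑ (allTrits n) (f ∘ neg) ≡ ∑ (allTrits n) f
∑-allTrits-neg zero f = refl
∑-allTrits-neg (suc n) f = begin
  ∑ (allTrits (suc n)) (f ∘ neg)                               ≡⟨ ∑-allTrits-suc n (f ∘ neg) ⟩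
  A (λ s → f (t- ∷ neg s)) + (A (λ s → f (t0 ∷ neg s)) + A (λ s → f (t+ ∷ neg s)))
    ≡⟨ cong₂ _+_ (∑-allTrits-neg n (f ∘ (t- ∷_))) (cong₂ _+_ (∑-allTrits-neg n (f ∘ (t0 ∷_))) (∑-allTrits-neg n (f ∘ (t+ ∷_)))) ⟩
  A (f ∘ (t- ∷_)) + (A (f ∘ (t0 ∷_)) + A (f ∘ (t+ ∷_)))          ≡⟨ swap (A (f ∘ (t- ∷_))) (A (f ∘ (t0 ∷_))) (A (f ∘ (t+ ∷_))) ⟩
  A (f ∘ (t+ ∷_)) + (A (f ∘ (t0 ∷_)) + A (f ∘ (t- ∷_)))          ≡⟨ sym (∑-allTrits-suc n f) ⟩
  ∑ (allTrits (suc n)) f ∎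
  where
  A : (Vec Trit n → ℤ) → ℤ
  A = ∑ (allTrits n)
  swap : ∀ a b c → a + (b + c) ≡ c + (b + a)
  swap = solve-∀

-- Each nonzero s is either in S or the negative of an element of S.
∑-allTrits-± : ∀ n (f : Vec Trit n → ℤ) →
  ∑ (allTrits n) f ≡ f (zeros n) + ∑ (allTrits n) (λ s → ⟦ isS s ⟧ * (f s + f (neg s)))
∑-allTrits-± zero f = refl
∑-allTrits-± (suc n) f = begin
  ∑ (allTrits (suc n)) f                  ≡⟨ ∑-allTrits-suc n f ⟩
  a+ + (∑ (allTrits n) (f ∘ (t0 ∷_)) + a-)
    ≡⟨ cong₂ (λ u v → a+ + (u + v)) (∑-allTrits-± n (f ∘ (t0 ∷_))) (sym (∑-allTrits-neg n (f ∘ (t- ∷_)))) ⟩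
  a+ + ((f (zeros (suc n)) + b0) + a-∘neg)  ≡⟨ rearrange a+ a-∘neg (f (zeros (suc n))) b0 ⟩
  f (zeros (suc n)) + ((a+ + a-∘neg) + (b0 + + 0))
    ≡⟨ cong₂ (λ u v → f (zeros (suc n)) + (u + (b0 + v))) plus (sym (∑-zero (allTrits n))) ⟩
  f (zeros (suc n)) + (∑ (allTrits n) (g ∘ (t+ ∷_)) + (∑ (allTrits n) (g ∘ (t0 ∷_)) + ∑ (allTrits n) (g ∘ (t- ∷_))))
    ≡⟨ cong (_+_ (f (zeros (suc n)))) (sym (∑-allTrits-suc n g)) ⟩
  f (zeros (suc n)) + ∑ (allTrits (suc n)) g ∎
  where
  g : Vec Trit (suc n) → ℤ
  g s = ⟦ isS s ⟧ * (f s + f (neg s))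
  a+ = ∑ (allTrits n) (f ∘ (t+ ∷_))
  a- = ∑ (allTrits n) (f ∘ (t- ∷_))
  a-∘neg = ∑ (allTrits n) (λ s → f (t- ∷ neg s))
  b0 = ∑ (allTrits n) (λ s → ⟦ isS s ⟧ * (f (t0 ∷ s) + f (t0 ∷ neg s)))
  rearrange : ∀ a b c d → a + ((c + d) + b) ≡ c + ((a + b) + (d + + 0))
  rearrange = solve-∀
  plus : a+ + a-∘neg ≡ ∑ (allTrits n) (g ∘ (t+ ∷_))
  plus = trans (sym (∑-+ (allTrits n) (f ∘ (t+ ∷_)) _)) (∑-cong (allTrits n) (λ s → sym (*-identityˡ _)))

∈-allBools : ∀ {m} (a : Vec Bool m) → a ∈ allBools m
∈-allBools [] = here refl
∈-allBools {suc m} (false ∷ a) = ∈-++⁺ˡ (∈-map⁺ (false ∷_) (∈-allBools a))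
∈-allBools {suc m} (true ∷ a) = ∈-++⁺ʳ (map (false ∷_) (allBools m)) (∈-++⁺ˡ (∈-map⁺ (true ∷_) (∈-allBools a)))

agreesAt : Bool → Quad → Trit → Bool
agreesAt k a b = if nzQ a ∧ nzT b then a ==Q scale k b else true

agrees : ∀ {n} → Bool → Vec Quad n → Vec Trit n → Bool
agrees k t s = and (toList (zipWith (agreesAt k) t s))

meets : ∀ {n} → Vec Quad n → Vec Trit n → Bool
meets t s = or (toList (zipWith (λ a b → nzQ a ∧ nzT b) t s))

avoidsU : ∀ {n} → Vec Quad n → Vec Trit n → Bool
avoidsU t s = and (toList (zipWith (λ a b → if a ==Q qu then b ==T t0 else true) t s))

¬meets⇒agrees : ∀ {n} k (t : Vec Quad n) s → meets t s ≡ false → agrees k t s ≡ true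
¬meets⇒agrees k [] [] _ = refl
¬meets⇒agrees k (a ∷ t) (b ∷ s) h with nzQ a ∧ nzT b
... | false = ¬meets⇒agrees k t s h

agreesAt-exclusive : ∀ a b → nzQ a ∧ nzT b ≡ true → a ==Q scale true b ≡ true → a ==Q scale false b ≡ false
agreesAt-exclusive q1 t+ _ _ = refl
agreesAt-exclusive qm t- _ _ = refl
agreesAt-exclusive q0 _ () _
agreesAt-exclusive q1 t0 () _
agreesAt-exclusive qm t0 () _
agreesAt-exclusive qu t0 () _
agreesAt-exclusive q1 t- _ ()
agreesAt-exclusive qm t+ _ ()
agreesAt-exclusive qu t+ _ ()
agreesAt-exclusive qu t- _ ()

meets⇒agrees-exclusive : ∀ {n} (t : Vec Quad n) s →
  meets t s ≡ true → agrees true t s ≡ true → agrees false t s ≡ false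
meets⇒agrees-exclusive [] [] () _
meets⇒agrees-exclusive (a ∷ t) (b ∷ s) h g with nzQ a ∧ nzT b in ab
... | false = meets⇒agrees-exclusive t s h g
... | true rewrite agreesAt-exclusive a b ab (∧≡true⇒left g) = refl

avoidsU-embed : ∀ {n} (x : Vec Trit n) s → avoidsU (V.map embed x) s ≡ true
avoidsU-embed [] [] = refl
avoidsU-embed (t+ ∷ x) (_ ∷ s) = avoidsU-embed x s
avoidsU-embed (t0 ∷ x) (_ ∷ s) = avoidsU-embed x s
avoidsU-embed (t- ∷ x) (_ ∷ s) = avoidsU-embed x s

weight : Trit → ℤ
weight t+ = + 1
weight t0 = - (+ 2)
weight t- = + 1

rowCond : ∀ {n} → Trit → Vec Trit n → Vec Trit n → Bool
rowCond t+ x s = agrees true (V.map embed x) s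
rowCond t0 x s = not (meets (V.map embed x) s)
rowCond t- x s = agrees false (V.map embed x) s

-- Disjoint supports make both agreements vacuous; otherwise at most one of them holds.
⟦eliminates⟧ : ∀ {n} (x : Vec Trit n) s → ⟦ eliminates (V.map embed x) s ⟧ ≡
  weight t+ * ⟦ rowCond t+ x s ⟧ + (weight t0 * ⟦ rowCond t0 x s ⟧ + weight t- * ⟦ rowCond t- x s ⟧)
⟦eliminates⟧ x s rewrite avoidsU-embed x s =
  split (meets t s) (agrees true t s) (agrees false t s)
        (¬meets⇒agrees true t s) (¬meets⇒agrees false t s) (meets⇒agrees-exclusive t s)
  where
  t = V.map embed x
  split : ∀ c a b → (c ≡ false → a ≡ true) → (c ≡ false → b ≡ true) → (c ≡ true → a ≡ true → b ≡ false) →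
    ⟦ c ∧ ((a ∨ (b ∨ false)) ∧ true) ⟧ ≡ + 1 * ⟦ a ⟧ + (- (+ 2) * ⟦ not c ⟧ + + 1 * ⟦ b ⟧)
  split false a b a≡true b≡true _ rewrite a≡true refl | b≡true refl = refl
  split true true b _ _ excl rewrite excl refl refl = refl
  split true false true _ _ _ = refl
  split true false false _ _ _ = refl

meets-neg : ∀ {n} (t : Vec Quad n) s → meets t (neg s) ≡ meets t s
meets-neg [] [] = refl
meets-neg (a ∷ t) (t+ ∷ s) = cong (nzQ a ∧ true ∨_) (meets-neg t s)
meets-neg (a ∷ t) (t0 ∷ s) = cong (nzQ a ∧ false ∨_) (meets-neg t s)
meets-neg (a ∷ t) (t- ∷ s) = cong (nzQ a ∧ true ∨_) (meets-neg t s)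

avoidsU-neg : ∀ {n} (t : Vec Quad n) s → avoidsU t (neg s) ≡ avoidsU t s
avoidsU-neg [] [] = refl
avoidsU-neg (a ∷ t) (t+ ∷ s) = cong ((if a ==Q qu then false else true) ∧_) (avoidsU-neg t s)
avoidsU-neg (a ∷ t) (t0 ∷ s) = cong ((if a ==Q qu then true else true) ∧_) (avoidsU-neg t s)
avoidsU-neg (a ∷ t) (t- ∷ s) = cong ((if a ==Q qu then false else true) ∧_) (avoidsU-neg t s)

agreesAt-neg : ∀ k a b → agreesAt k a (negT b) ≡ agreesAt (not k) a b
agreesAt-neg true a t+ = refl
agreesAt-neg true a t0 = refl
agreesAt-neg true a t- = refl
agreesAt-neg false a t+ = refl
agreesAt-neg false a t0 = refl
agreesAt-neg false a t- = refl

agrees-neg : ∀ {n} k (t : Vec Quad n) s → agrees k t (neg s) ≡ agrees (not k) t s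
agrees-neg k [] [] = refl
agrees-neg k (a ∷ t) (b ∷ s) = cong₂ _∧_ (agreesAt-neg k a b) (agrees-neg k t s)

eliminates-neg : ∀ {n} (t : Vec Quad n) s → eliminates t (neg s) ≡ eliminates t s
eliminates-neg t s
  rewrite meets-neg t s | avoidsU-neg t s | agrees-neg true t s | agrees-neg false t s
        | ∨-identityʳ (agrees true t s) | ∨-identityʳ (agrees false t s)
  = cong (λ u → meets t s ∧ (u ∧ avoidsU t s)) (∨-comm (agrees false t s) (agrees true t s))

meets-zeros : ∀ {n} (t : Vec Quad n) → meets t (zeros n) ≡ false
meets-zeros [] = refl
meets-zeros (q1 ∷ t) = meets-zeros t
meets-zeros (q0 ∷ t) = meets-zeros t
meets-zeros (qm ∷ t) = meets-zeros t
meets-zeros (qu ∷ t) = meets-zeros t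

eliminatedByAll : ∀ {m n} → Vec (Vec Trit n) m → Vec Trit n → Bool
eliminatedByAll X s = and (toList (V.map (λ x → eliminates (V.map embed x) s) X))

eliminatedByAll-neg : ∀ {m n} (X : Vec (Vec Trit n) m) s → eliminatedByAll X (neg s) ≡ eliminatedByAll X s
eliminatedByAll-neg [] s = refl
eliminatedByAll-neg (x ∷ X) s = cong₂ _∧_ (eliminates-neg (V.map embed x) s) (eliminatedByAll-neg X s)

eliminatedByAll-zeros : ∀ {m n} (X : Vec (Vec Trit n) (suc m)) → eliminatedByAll X (zeros n) ≡ false
eliminatedByAll-zeros (x ∷ X) rewrite meets-zeros (V.map embed x) = refl

rowConds : ∀ {m n} → Vec Trit m → Vec (Vec Trit n) m → Vec Trit n → Bool
rowConds [] [] s = true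
rowConds (b ∷ β) (x ∷ X) s = rowCond b x s ∧ rowConds β X s

weight-zcount-cons : ∀ {m} b (β : Vec Trit m) → weight b * (- (+ 2)) ^ zcount β ≡ (- (+ 2)) ^ zcount (b ∷ β)
weight-zcount-cons t+ β = *-identityˡ _
weight-zcount-cons t0 β = refl
weight-zcount-cons t- β = *-identityˡ _

⟦eliminatedByAll⟧ : ∀ {m n} (X : Vec (Vec Trit n) m) s →
  ⟦ eliminatedByAll X s ⟧ ≡ ∑ (allTrits m) (λ β → (- (+ 2)) ^ zcount β * ⟦ rowConds β X s ⟧)
⟦eliminatedByAll⟧ [] s = refl
⟦eliminatedByAll⟧ {suc m} (x ∷ X) s = begin
  ⟦ e ∧ eliminatedByAll X s ⟧                                     ≡⟨ ⟦∧⟧ e _ ⟩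
  ⟦ e ⟧ * ⟦ eliminatedByAll X s ⟧                                 ≡⟨ cong₂ _*_ (⟦eliminates⟧ x s) (⟦eliminatedByAll⟧ X s) ⟩
  (c t+ + (c t0 + c t-)) * ∑ (allTrits m) f                      ≡⟨ distribʳ (c t+) (c t0) (c t-) _ ⟩
  c t+ * ∑ (allTrits m) f + (c t0 * ∑ (allTrits m) f + c t- * ∑ (allTrits m) f)
    ≡⟨ cong₂ _+_ (branch t+) (cong₂ _+_ (branch t0) (branch t-)) ⟩
  ∑ (allTrits m) (g ∘ (t+ ∷_)) + (∑ (allTrits m) (g ∘ (t0 ∷_)) + ∑ (allTrits m) (g ∘ (t- ∷_)))
    ≡⟨ sym (∑-allTrits-suc m g) ⟩
  ∑ (allTrits (suc m)) g ∎
  where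
  e = eliminates (V.map embed x) s
  c : Trit → ℤ
  c b = weight b * ⟦ rowCond b x s ⟧
  f : Vec Trit m → ℤ
  f β = (- (+ 2)) ^ zcount β * ⟦ rowConds β X s ⟧
  g : Vec Trit (suc m) → ℤ
  g β = (- (+ 2)) ^ zcount β * ⟦ rowConds β (x ∷ X) s ⟧
  distribʳ : ∀ a b d r → (a + (b + d)) * r ≡ a * r + (b * r + d * r)
  distribʳ = solve-∀
  interchange : ∀ w u p r → (w * u) * (p * r) ≡ (w * p) * (u * r)
  interchange = solve-∀
  extend : ∀ b β → c b * f β ≡ g (b ∷ β)
  extend b β = trans (interchange (weight b) ⟦ rowCond b x s ⟧ _ _)
    (cong₂ _*_ (weight-zcount-cons b β) (sym (⟦∧⟧ (rowCond b x s) (rowConds β X s))))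
  branch : ∀ b → c b * ∑ (allTrits m) f ≡ ∑ (allTrits m) (g ∘ (b ∷_))
  branch b = trans (sym (∑-distribˡ (allTrits m) (c b) f)) (∑-cong (allTrits m) (extend b))

entryCond : Trit → Trit → Trit → Bool
entryCond t+ c t = agreesAt true (embed c) t
entryCond t0 c t = not (nzQ (embed c) ∧ nzT t)
entryCond t- c t = agreesAt false (embed c) t

-- For t = ±1, columnCond β c t says that c arises from t·β by zeroing some coordinates.
columnCond : ∀ {m} → Vec Trit m → Vec Trit m → Trit → Bool
columnCond [] [] t = true
columnCond (b ∷ β) (c ∷ cs) t = entryCond b c t ∧ columnCond β cs t

rowCond-nil : ∀ b → rowCond b [] [] ≡ true
rowCond-nil t+ = refl
rowCond-nil t0 = refl
rowCond-nil t- = refl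

rowCond-cons : ∀ {n} b c (x : Vec Trit n) t s → rowCond b (c ∷ x) (t ∷ s) ≡ entryCond b c t ∧ rowCond b x s
rowCond-cons t+ c x t s = refl
rowCond-cons t0 c x t s = not-∨ (nzQ (embed c) ∧ nzT t) (meets (V.map embed x) s)
  where
  not-∨ : ∀ a b → not (a ∨ b) ≡ not a ∧ not b
  not-∨ true b = refl
  not-∨ false b = refl
rowCond-cons t- c x t s = refl

rowConds-nil : ∀ {m} (β : Vec Trit m) (X : Vec (Vec Trit 0) m) → rowConds β X [] ≡ true
rowConds-nil [] [] = refl
rowConds-nil (b ∷ β) ([] ∷ X) rewrite rowCond-nil b = rowConds-nil β X

rowConds-cons : ∀ {m n} (β : Vec Trit m) (X : Vec (Vec Trit (suc n)) m) t s →
  rowConds β X (t ∷ s) ≡ columnCond β (V.map V.head X) t ∧ rowConds β (V.map V.tail X) s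
rowConds-cons [] [] t s = refl
rowConds-cons (b ∷ β) ((c ∷ x) ∷ X) t s =
  trans (cong₂ _∧_ (rowCond-cons b c x t s) (rowConds-cons β X t s)) (∧-interchange (entryCond b c t) _ _ _)

isZero : ∀ {m} → Vec Trit m → Bool
isZero c = and (toList (V.map (λ x → x ==T t0) c))

bspWitness : ∀ {m} → Vec Trit m → Vec Trit m → Vec Bool m → Bool
bspWitness c α a = or (toList a) ∧ or (toList (V.map nzT (combo a α))) ∧ (c ==V combo a α ∨ c ==V neg (combo a α))

inBSp : ∀ {m} → Vec Trit m → Vec Trit m → Bool
inBSp {m} c α = any (bspWitness c α) (allBools m)

count-cons : ∀ b bs → count (b ∷ bs) ≡ toℕ b ℕ.+ count bs
count-cons true bs = refl
count-cons false bs = refl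

column-zero : ∀ {m n} (X : Vec (Vec Trit (suc n)) m) → column X Fin.zero ≡ V.map V.head X
column-zero X = VP.map-cong (λ { (c ∷ r) → refl }) X

column-suc : ∀ {m n} (X : Vec (Vec Trit (suc n)) m) j → column X (Fin.suc j) ≡ column (V.map V.tail X) j
column-suc X j = trans (VP.map-cong (λ { (c ∷ r) → refl }) X) (VP.map-∘ (λ row → lookup row j) V.tail X)

countColumns-cons : ∀ {m n} (p : Vec Trit m → Bool) (X : Vec (Vec Trit (suc n)) m) →
  count (toList (tabulate (p ∘ column X))) ≡ toℕ (p (V.map V.head X)) ℕ.+ count (toList (tabulate (p ∘ column (V.map V.tail X))))
countColumns-cons p X = trans (count-cons (p (column X Fin.zero)) _)
  (cong₂ (λ c cs → toℕ (p c) ℕ.+ count (toList cs)) (column-zero X) (VP.tabulate-cong (cong p ∘ column-suc X)))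

zX-cons : ∀ {m n} (X : Vec (Vec Trit (suc n)) m) → zX X ≡ toℕ (isZero (V.map V.head X)) ℕ.+ zX (V.map V.tail X)
zX-cons = countColumns-cons isZero

bsp-cons : ∀ {m n} (X : Vec (Vec Trit (suc n)) m) β → bsp X β ≡ toℕ (inBSp (V.map V.head X) β) ℕ.+ bsp (V.map V.tail X) β
bsp-cons X β = countColumns-cons (λ c → inBSp c β) X

¬isZero≡nonzero : ∀ {m} (c : Vec Trit m) → not (isZero c) ≡ or (toList (V.map nzT c))
¬isZero≡nonzero [] = refl
¬isZero≡nonzero (t+ ∷ c) = refl
¬isZero≡nonzero (t0 ∷ c) = ¬isZero≡nonzero c
¬isZero≡nonzero (t- ∷ c) = refl

==V⇒≡ : ∀ {m} (u v : Vec Trit m) → T (u ==V v) → u ≡ v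
==V⇒≡ [] [] _ = refl
==V⇒≡ (t+ ∷ u) (t+ ∷ v) h = cong (t+ ∷_) (==V⇒≡ u v h)
==V⇒≡ (t0 ∷ u) (t0 ∷ v) h = cong (t0 ∷_) (==V⇒≡ u v h)
==V⇒≡ (t- ∷ u) (t- ∷ v) h = cong (t- ∷_) (==V⇒≡ u v h)

==V-refl : ∀ {m} (u : Vec Trit m) → T (u ==V u)
==V-refl [] = _
==V-refl (t+ ∷ u) = ==V-refl u
==V-refl (t0 ∷ u) = ==V-refl u
==V-refl (t- ∷ u) = ==V-refl u

columnCond-t0 : ∀ {m} (β c : Vec Trit m) → columnCond β c t0 ≡ true
columnCond-t0 [] [] = refl
columnCond-t0 (t+ ∷ β) (t+ ∷ c) = columnCond-t0 β c
columnCond-t0 (t+ ∷ β) (t0 ∷ c) = columnCond-t0 β c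
columnCond-t0 (t+ ∷ β) (t- ∷ c) = columnCond-t0 β c
columnCond-t0 (t0 ∷ β) (t+ ∷ c) = columnCond-t0 β c
columnCond-t0 (t0 ∷ β) (t0 ∷ c) = columnCond-t0 β c
columnCond-t0 (t0 ∷ β) (t- ∷ c) = columnCond-t0 β c
columnCond-t0 (t- ∷ β) (t+ ∷ c) = columnCond-t0 β c
columnCond-t0 (t- ∷ β) (t0 ∷ c) = columnCond-t0 β c
columnCond-t0 (t- ∷ β) (t- ∷ c) = columnCond-t0 β c

columnCond-isZero : ∀ {m} (β c : Vec Trit m) t → isZero c ≡ true → columnCond β c t ≡ true
columnCond-isZero [] [] t _ = refl
columnCond-isZero (t+ ∷ β) (t0 ∷ c) t z = columnCond-isZero β c t z
columnCond-isZero (t0 ∷ β) (t0 ∷ c) t z = columnCond-isZero β c t z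
columnCond-isZero (t- ∷ β) (t0 ∷ c) t z = columnCond-isZero β c t z

columnCond-exclusive : ∀ {m} (β c : Vec Trit m) →
  isZero c ≡ false → columnCond β c t+ ≡ true → columnCond β c t- ≡ true → ⊥
columnCond-exclusive [] [] () _ _
columnCond-exclusive (t+ ∷ β) (t0 ∷ c) z p q = columnCond-exclusive β c z p q
columnCond-exclusive (t0 ∷ β) (t0 ∷ c) z p q = columnCond-exclusive β c z p q
columnCond-exclusive (t- ∷ β) (t0 ∷ c) z p q = columnCond-exclusive β c z p q
columnCond-exclusive (t+ ∷ β) (t- ∷ c) z () q
columnCond-exclusive (t- ∷ β) (t+ ∷ c) z () q
columnCond-exclusive (t0 ∷ β) (t+ ∷ c) z () q
columnCond-exclusive (t0 ∷ β) (t- ∷ c) z () q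
columnCond-exclusive (t+ ∷ β) (t+ ∷ c) z p ()
columnCond-exclusive (t- ∷ β) (t- ∷ c) z p ()

combo-columnCond+ : ∀ {m} (a : Vec Bool m) β → T (columnCond β (combo a β) t+)
combo-columnCond+ [] [] = _
combo-columnCond+ (true ∷ a) (t+ ∷ β) = combo-columnCond+ a β
combo-columnCond+ (true ∷ a) (t0 ∷ β) = combo-columnCond+ a β
combo-columnCond+ (true ∷ a) (t- ∷ β) = combo-columnCond+ a β
combo-columnCond+ (false ∷ a) (t+ ∷ β) = combo-columnCond+ a β
combo-columnCond+ (false ∷ a) (t0 ∷ β) = combo-columnCond+ a β
combo-columnCond+ (false ∷ a) (t- ∷ β) = combo-columnCond+ a β

combo-columnCond- : ∀ {m} (a : Vec Bool m) β → T (columnCond β (neg (combo a β)) t-)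
combo-columnCond- [] [] = _
combo-columnCond- (true ∷ a) (t+ ∷ β) = combo-columnCond- a β
combo-columnCond- (true ∷ a) (t0 ∷ β) = combo-columnCond- a β
combo-columnCond- (true ∷ a) (t- ∷ β) = combo-columnCond- a β
combo-columnCond- (false ∷ a) (t+ ∷ β) = combo-columnCond- a β
combo-columnCond- (false ∷ a) (t0 ∷ β) = combo-columnCond- a β
combo-columnCond- (false ∷ a) (t- ∷ β) = combo-columnCond- a β

columnCond+⇒combo : ∀ {m} (β c : Vec Trit m) → T (columnCond β c t+) → combo (V.map nzT c) β ≡ c
columnCond+⇒combo [] [] _ = refl
columnCond+⇒combo (t+ ∷ β) (t+ ∷ c) h = cong (t+ ∷_) (columnCond+⇒combo β c h)
columnCond+⇒combo (t+ ∷ β) (t0 ∷ c) h = cong (t0 ∷_) (columnCond+⇒combo β c h)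
columnCond+⇒combo (t0 ∷ β) (t0 ∷ c) h = cong (t0 ∷_) (columnCond+⇒combo β c h)
columnCond+⇒combo (t- ∷ β) (t0 ∷ c) h = cong (t0 ∷_) (columnCond+⇒combo β c h)
columnCond+⇒combo (t- ∷ β) (t- ∷ c) h = cong (t- ∷_) (columnCond+⇒combo β c h)

columnCond-⇒combo : ∀ {m} (β c : Vec Trit m) → T (columnCond β c t-) → combo (V.map nzT c) β ≡ neg c
columnCond-⇒combo [] [] _ = refl
columnCond-⇒combo (t+ ∷ β) (t0 ∷ c) h = cong (t0 ∷_) (columnCond-⇒combo β c h)
columnCond-⇒combo (t+ ∷ β) (t- ∷ c) h = cong (t+ ∷_) (columnCond-⇒combo β c h)
columnCond-⇒combo (t0 ∷ β) (t0 ∷ c) h = cong (t0 ∷_) (columnCond-⇒combo β c h)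
columnCond-⇒combo (t- ∷ β) (t+ ∷ c) h = cong (t- ∷_) (columnCond-⇒combo β c h)
columnCond-⇒combo (t- ∷ β) (t0 ∷ c) h = cong (t0 ∷_) (columnCond-⇒combo β c h)

inBSp⇒ : ∀ {m} (c β : Vec Trit m) → T (inBSp c β) → T (not (isZero c) ∧ (columnCond β c t+ ∨ columnCond β c t-))
inBSp⇒ {m} c β h with satisfied (any⁻ _ (allBools m) h)
... | a , w with to T-∧ (proj₂ (to (T-∧ {or (toList a)}) w))
... | nz , eq with to T-∨ eq
... | inj₁ e rewrite ==V⇒≡ c _ e =
  from T-∧ (subst T (sym (¬isZero≡nonzero (combo a β))) nz , from T-∨ (inj₁ (combo-columnCond+ a β)))
... | inj₂ e rewrite ==V⇒≡ c _ e =
  from T-∧ (subst T (sym (trans (¬isZero≡nonzero (neg (combo a β))) (cong (or ∘ toList) (nzT-neg (combo a β))))) nz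
           , from T-∨ (inj₂ (combo-columnCond- a β)))

⇒inBSp : ∀ {m} (c β : Vec Trit m) → T (not (isZero c)) →
  T (columnCond β c t+) ⊎ T (columnCond β c t-) → T (inBSp c β)
⇒inBSp c β nz cond = any⁺ _ (lose (∈-allBools (V.map nzT c)) (witness cond))
  where
  nz′ : T (or (toList (V.map nzT c)))
  nz′ = subst T (¬isZero≡nonzero c) nz
  witness : T (columnCond β c t+) ⊎ T (columnCond β c t-) → T (bspWitness c β (V.map nzT c))
  witness (inj₁ h) rewrite columnCond+⇒combo β c h = from T-∧ (nz′ , from T-∧ (nz′ , from T-∨ (inj₁ (==V-refl c))))
  witness (inj₂ h) rewrite columnCond-⇒combo β c h | nzT-neg c | neg-involutive c =
    from T-∧ (nz′ , from T-∧ (nz′ , from T-∨ (inj₂ (==V-refl c))))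

inBSp-char : ∀ {m} (c β : Vec Trit m) → inBSp c β ≡ not (isZero c) ∧ (columnCond β c t+ ∨ columnCond β c t-)
inBSp-char c β = T-ext (inBSp⇒ c β) λ h → ⇒inBSp c β (proj₁ (to T-∧ h)) (to T-∨ (proj₂ (to T-∧ h)))

-- The entries of s in one column can be chosen in 3 ways for a zero column,
-- in 2 ways (0 and one sign) for a column in BSp, and only as 0 otherwise.
columnCount : ∀ {m} (β c : Vec Trit m) →
  ⟦ columnCond β c t+ ⟧ + (⟦ columnCond β c t0 ⟧ + ⟦ columnCond β c t- ⟧) ≡ (+ 3) ^ toℕ (isZero c) * (+ 2) ^ toℕ (inBSp c β)
columnCount β c rewrite columnCond-t0 β c | inBSp-char c β with isZero c in z
... | true rewrite columnCond-isZero β c t+ z | columnCond-isZero β c t- z = refl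
... | false with columnCond β c t+ in e+ | columnCond β c t- in e-
...   | true | true = ⊥-elim (columnCond-exclusive β c z e+ e-)
...   | true | false = refl
...   | false | true = refl
...   | false | false = refl

∑-rowConds : ∀ {m} n (β : Vec Trit m) (X : Vec (Vec Trit n) m) →
  ∑ (allTrits n) (⟦_⟧ ∘ rowConds β X) ≡ (+ 3) ^ zX X * (+ 2) ^ bsp X β
∑-rowConds zero β X rewrite rowConds-nil β X = refl
∑-rowConds (suc n) β X = begin
  ∑ (allTrits (suc n)) (⟦_⟧ ∘ rowConds β X)                     ≡⟨ ∑-allTrits-suc n _ ⟩
  Σ t+ + (Σ t0 + Σ t-)                                          ≡⟨ cong₂ _+_ (firstColumn t+) (cong₂ _+_ (firstColumn t0) (firstColumn t-)) ⟩
  ⟦ cc t+ ⟧ * rest + (⟦ cc t0 ⟧ * rest + ⟦ cc t- ⟧ * rest)         ≡⟨ factor ⟦ cc t+ ⟧ ⟦ cc t0 ⟧ ⟦ cc t- ⟧ rest ⟩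
  (⟦ cc t+ ⟧ + (⟦ cc t0 ⟧ + ⟦ cc t- ⟧)) * rest                     ≡⟨ cong₂ _*_ (columnCount β hd) (∑-rowConds n β tl) ⟩
  ((+ 3) ^ z₀ * (+ 2) ^ b₀) * ((+ 3) ^ zX tl * (+ 2) ^ bsp tl β)   ≡⟨ interchange ((+ 3) ^ z₀) ((+ 2) ^ b₀) _ _ ⟩
  ((+ 3) ^ z₀ * (+ 3) ^ zX tl) * ((+ 2) ^ b₀ * (+ 2) ^ bsp tl β)
    ≡⟨ sym (cong₂ _*_ (^-distribˡ-+-* (+ 3) z₀ (zX tl)) (^-distribˡ-+-* (+ 2) b₀ (bsp tl β))) ⟩
  (+ 3) ^ (z₀ ℕ.+ zX tl) * (+ 2) ^ (b₀ ℕ.+ bsp tl β)             ≡⟨ sym (cong₂ (λ a b → (+ 3) ^ a * (+ 2) ^ b) (zX-cons X) (bsp-cons X β)) ⟩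
  (+ 3) ^ zX X * (+ 2) ^ bsp X β ∎
  where
  hd = V.map V.head X
  tl = V.map V.tail X
  z₀ = toℕ (isZero hd)
  b₀ = toℕ (inBSp hd β)
  cc : Trit → Bool
  cc = columnCond β hd
  rest = ∑ (allTrits n) (⟦_⟧ ∘ rowConds β tl)
  Σ : Trit → ℤ
  Σ t = ∑ (allTrits n) (λ s → ⟦ rowConds β X (t ∷ s) ⟧)
  firstColumn : ∀ t → Σ t ≡ ⟦ cc t ⟧ * rest
  firstColumn t = trans (∑-cong (allTrits n) (λ s → trans (cong ⟦_⟧ (rowConds-cons β X t s)) (⟦∧⟧ (cc t) _)))
                        (∑-distribˡ (allTrits n) ⟦ cc t ⟧ (⟦_⟧ ∘ rowConds β tl))
  factor : ∀ a b c r → a * r + (b * r + c * r) ≡ (a + (b + c)) * r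
  factor = solve-∀
  interchange : ∀ a b c d → (a * b) * (c * d) ≡ (a * c) * (b * d)
  interchange = solve-∀

zcount-neg : ∀ {m} (β : Vec Trit m) → zcount (neg β) ≡ zcount β
zcount-neg [] = refl
zcount-neg (t+ ∷ β) = zcount-neg β
zcount-neg (t0 ∷ β) = cong suc (zcount-neg β)
zcount-neg (t- ∷ β) = zcount-neg β

zcount-zeros : ∀ m → zcount (zeros m) ≡ m
zcount-zeros zero = refl
zcount-zeros (suc m) = cong suc (zcount-zeros m)

columnCond-neg : ∀ {m} (β c : Vec Trit m) t → columnCond (neg β) c t ≡ columnCond β c (negT t)
columnCond-neg [] [] t = refl
columnCond-neg (b ∷ β) (c ∷ cs) t = cong₂ _∧_ (entryCond-neg b t) (columnCond-neg β cs t)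
  where
  entryCond-neg : ∀ b t → entryCond (negT b) c t ≡ entryCond b c (negT t)
  entryCond-neg t+ t+ = refl
  entryCond-neg t+ t0 = refl
  entryCond-neg t+ t- = refl
  entryCond-neg t0 t+ = refl
  entryCond-neg t0 t0 = refl
  entryCond-neg t0 t- = refl
  entryCond-neg t- t+ = refl
  entryCond-neg t- t0 = refl
  entryCond-neg t- t- = refl

columnCond-zeros : ∀ {m} (c : Vec Trit m) t → nzT t ≡ true → columnCond (zeros m) c t ≡ isZero c
columnCond-zeros [] t _ = refl
columnCond-zeros (t+ ∷ c) t+ _ = refl
columnCond-zeros (t+ ∷ c) t- _ = refl
columnCond-zeros (t0 ∷ c) t h = columnCond-zeros c t h
columnCond-zeros (t- ∷ c) t+ _ = refl
columnCond-zeros (t- ∷ c) t- _ = refl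

countColumns-cong : ∀ {m n} (X : Vec (Vec Trit n) m) {p q : Vec Trit m → Bool} → (∀ c → p c ≡ q c) →
  count (toList (tabulate (p ∘ column X))) ≡ count (toList (tabulate (q ∘ column X)))
countColumns-cong X p≗q = cong (count ∘ toList) (VP.tabulate-cong (p≗q ∘ column X))

bsp-neg : ∀ {m n} (X : Vec (Vec Trit n) m) β → bsp X (neg β) ≡ bsp X β
bsp-neg X β = countColumns-cong X inBSp-neg
  where
  inBSp-neg : ∀ c → inBSp c (neg β) ≡ inBSp c β
  inBSp-neg c rewrite inBSp-char c (neg β) | inBSp-char c β | columnCond-neg β c t+ | columnCond-neg β c t- =
    cong (not (isZero c) ∧_) (∨-comm (columnCond β c t-) (columnCond β c t+))

bsp-zeros : ∀ {m n} (X : Vec (Vec Trit n) m) → bsp X (zeros m) ≡ 0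
bsp-zeros {m} {n} X = trans (countColumns-cong X inBSp-zeros) (count-false n)
  where
  inBSp-zeros : ∀ c → inBSp c (zeros m) ≡ false
  inBSp-zeros c rewrite inBSp-char c (zeros m) | columnCond-zeros c t+ refl | columnCond-zeros c t- refl with isZero c
  ... | true = refl
  ... | false = refl
  count-false : ∀ n → count (toList (tabulate {n = n} (λ _ → false))) ≡ 0
  count-false zero = refl
  count-false (suc n) = count-false n

-1^z*2^z+b≡-2^z*2^b : ∀ z b → (- (+ 1)) ^ z * (+ 2) ^ (z ℕ.+ b) ≡ (- (+ 2)) ^ z * (+ 2) ^ b
-1^z*2^z+b≡-2^z*2^b zero b = refl
-1^z*2^z+b≡-2^z*2^b (suc z) b = begin
  (- (+ 1) * (- (+ 1)) ^ z) * (+ 2 * (+ 2) ^ (z ℕ.+ b))   ≡⟨ pull ((- (+ 1)) ^ z) ((+ 2) ^ (z ℕ.+ b)) ⟩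
  - (+ 2) * ((- (+ 1)) ^ z * (+ 2) ^ (z ℕ.+ b))           ≡⟨ cong (_*_ (- (+ 2))) (-1^z*2^z+b≡-2^z*2^b z b) ⟩
  - (+ 2) * ((- (+ 2)) ^ z * (+ 2) ^ b)                   ≡⟨ sym (*-assoc (- (+ 2)) ((- (+ 2)) ^ z) ((+ 2) ^ b)) ⟩
  (- (+ 2) * (- (+ 2)) ^ z) * (+ 2) ^ b ∎
  where
  pull : ∀ x y → (- (+ 1) * x) * (+ 2 * y) ≡ - (+ 2) * (x * y)
  pull = solve-∀

∑-eliminatedByAll : ∀ {m n} (X : Vec (Vec Trit n) (suc m)) →
  ∑ (allTrits n) (⟦_⟧ ∘ eliminatedByAll X) ≡ + 2 * + card∩E X
∑-eliminatedByAll {n = n} X = begin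
  ∑ (allTrits n) e                                                      ≡⟨ ∑-allTrits-± n e ⟩
  e (zeros n) + ∑ (allTrits n) (λ s → ⟦ isS s ⟧ * (e s + e (neg s)))
    ≡⟨ cong₂ _+_ (cong ⟦_⟧ (eliminatedByAll-zeros X)) (∑-cong (allTrits n) double) ⟩
  + 0 + ∑ (allTrits n) (λ s → + 2 * (⟦ isS s ⟧ * e s))                ≡⟨ +-identityˡ _ ⟩
  ∑ (allTrits n) (λ s → + 2 * (⟦ isS s ⟧ * e s))                      ≡⟨ ∑-distribˡ (allTrits n) (+ 2) _ ⟩
  + 2 * ∑ (allTrits n) (λ s → ⟦ isS s ⟧ * e s)                        ≡⟨ cong (_*_ (+ 2)) (sym card) ⟩
  + 2 * + card∩E X ∎
  where
  e : Vec Trit n → ℤ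
  e = ⟦_⟧ ∘ eliminatedByAll X
  twice : ∀ i a → i * (a + a) ≡ + 2 * (i * a)
  twice = solve-∀
  double : ∀ s → ⟦ isS s ⟧ * (e s + e (neg s)) ≡ + 2 * (⟦ isS s ⟧ * e s)
  double s = trans (cong (λ u → ⟦ isS s ⟧ * (e s + ⟦ u ⟧)) (eliminatedByAll-neg X s)) (twice ⟦ isS s ⟧ (e s))
  card : + card∩E X ≡ ∑ (allTrits n) (λ s → ⟦ isS s ⟧ * e s)
  card = trans (length-filter (eliminatedByAll X) (S n)) (∑-filter isS (allTrits n) e)

∑-eliminatedByAll≡∑patterns : ∀ {m n} (X : Vec (Vec Trit n) m) → ∑ (allTrits n) (⟦_⟧ ∘ eliminatedByAll X) ≡
  ∑ (allTrits m) (λ β → (- (+ 2)) ^ zcount β * ((+ 3) ^ zX X * (+ 2) ^ bsp X β))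
∑-eliminatedByAll≡∑patterns {m} {n} X = begin
  ∑ (allTrits n) (⟦_⟧ ∘ eliminatedByAll X)                              ≡⟨ ∑-cong (allTrits n) (⟦eliminatedByAll⟧ X) ⟩
  ∑ (allTrits n) (λ s → ∑ (allTrits m) (λ β → w β * ⟦ rowConds β X s ⟧))  ≡⟨ ∑-comm (allTrits n) (allTrits m) _ ⟩
  ∑ (allTrits m) (λ β → ∑ (allTrits n) (λ s → w β * ⟦ rowConds β X s ⟧))
    ≡⟨ ∑-cong (allTrits m) (λ β → trans (∑-distribˡ (allTrits n) (w β) _) (cong (_*_ (w β)) (∑-rowConds n β X))) ⟩
  ∑ (allTrits m) (λ β → w β * ((+ 3) ^ zX X * (+ 2) ^ bsp X β)) ∎
  where
  w : Vec Trit m → ℤ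
  w β = (- (+ 2)) ^ zcount β

∑-patterns : ∀ {m n} (X : Vec (Vec Trit n) (suc m)) →
  ∑ (allTrits (suc m)) (λ β → (- (+ 2)) ^ zcount β * ((+ 3) ^ zX X * (+ 2) ^ bsp X β)) ≡ + 2 * rhs X
∑-patterns {m} X = begin
  ∑ (allTrits (suc m)) h                                                   ≡⟨ ∑-allTrits-± (suc m) h ⟩
  h (zeros (suc m)) + ∑ (allTrits (suc m)) (λ β → ⟦ isS β ⟧ * (h β + h (neg β)))
    ≡⟨ cong₂ _+_ zeroPattern (∑-cong (allTrits (suc m)) pairPatterns) ⟩
  (- (+ 2)) ^ suc m * Z + ∑ (allTrits (suc m)) (λ β → + 2 * Z * (⟦ isS β ⟧ * K β))
    ≡⟨ cong (_+_ ((- (+ 2)) ^ suc m * Z)) (∑-distribˡ (allTrits (suc m)) (+ 2 * Z) _) ⟩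
  (- (+ 2)) ^ suc m * Z + + 2 * Z * ∑ (allTrits (suc m)) (λ β → ⟦ isS β ⟧ * K β)
    ≡⟨ cong (λ u → (- (+ 2)) ^ suc m * Z + + 2 * Z * u) (sym (trans (sumℤ-map K (S (suc m))) (∑-filter isS (allTrits (suc m)) K))) ⟩
  (- (+ 2)) ^ suc m * Z + + 2 * Z * sumℤ (map K (S (suc m)))              ≡⟨ collect ((- (+ 2)) ^ m) Z _ ⟩
  + 2 * rhs X ∎
  where
  Z = (+ 3) ^ zX X
  h : Vec Trit (suc m) → ℤ
  h β = (- (+ 2)) ^ zcount β * (Z * (+ 2) ^ bsp X β)
  K : Vec Trit (suc m) → ℤ
  K α = (- (+ 1)) ^ zcount α * (+ 2) ^ (zcount α ℕ.+ bsp X α)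
  zeroPattern : h (zeros (suc m)) ≡ (- (+ 2)) ^ suc m * Z
  zeroPattern = trans (cong₂ (λ z b → (- (+ 2)) ^ z * (Z * (+ 2) ^ b)) (zcount-zeros (suc m)) (bsp-zeros X))
                      (cong (_*_ ((- (+ 2)) ^ suc m)) (*-identityʳ Z))
  h≡Z*K : ∀ β → h β ≡ Z * K β
  h≡Z*K β = trans (swap ((- (+ 2)) ^ zcount β) Z ((+ 2) ^ bsp X β))
                  (cong (_*_ Z) (sym (-1^z*2^z+b≡-2^z*2^b (zcount β) (bsp X β))))
    where
    swap : ∀ a z b → a * (z * b) ≡ z * (a * b)
    swap = solve-∀
  twice : ∀ i z k → i * (z * k + z * k) ≡ + 2 * z * (i * k)
  twice = solve-∀
  pairPatterns : ∀ β → ⟦ isS β ⟧ * (h β + h (neg β)) ≡ + 2 * Z * (⟦ isS β ⟧ * K β)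
  pairPatterns β = begin
    ⟦ isS β ⟧ * (h β + h (neg β))
      ≡⟨ cong (λ u → ⟦ isS β ⟧ * (h β + u)) (cong₂ (λ z b → (- (+ 2)) ^ z * (Z * (+ 2) ^ b)) (zcount-neg β) (bsp-neg X β)) ⟩
    ⟦ isS β ⟧ * (h β + h β)             ≡⟨ cong (λ u → ⟦ isS β ⟧ * (u + u)) (h≡Z*K β) ⟩
    ⟦ isS β ⟧ * (Z * K β + Z * K β)     ≡⟨ twice ⟦ isS β ⟧ Z (K β) ⟩
    + 2 * Z * (⟦ isS β ⟧ * K β) ∎
  collect : ∀ p z t → (- (+ 2) * p) * z + + 2 * z * t ≡ + 2 * (z * (- p + t))
  collect = solve-∀

mainTheorem10 : (m n : ℕ) → 1 ≤ m → (X : Vec (Vec Trit n) m)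
    → (∀ i → T (isS (lookup X i)))
    → (∀ i j → i ≢ j → lookup X i ≢ lookup X j)
    → + card∩E X ≡ rhs X
mainTheorem10 (suc m) n (s≤s _) X _ _ = *-cancelˡ-≡ (+ 2) (+ card∩E X) (rhs X) (begin
  + 2 * + card∩E X                          ≡⟨ sym (∑-eliminatedByAll X) ⟩
  ∑ (allTrits n) (⟦_⟧ ∘ eliminatedByAll X)  ≡⟨ ∑-eliminatedByAll≡∑patterns X ⟩
  _                                         ≡⟨ ∑-patterns X ⟩
  + 2 * rhs X ∎)
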